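{- The class of graphs that do not contain $K_3\cup K_1$ as an induced minor does not have bounded clique-width.
   Context: Graphs are finite and simple. $H$ is an induced minor of $G$ if a graph isomorphic to $H$ can be obtained from $G$ by vertex deletions and edge contractions. $K_3\cup K_1$ is the disjoint union of a triangle and an isolated vertex. The clique-width of $G$ is the minimum number of labels needed to construct $G$ using: creating a vertex with label $i$; disjoint union; adding all edges between label-$i$ and label-$j$ vertices ($i\ne j$); renaming label $i$ to $j$. A class has bounded clique-width if some constant bounds the clique-width of all its members. -}

module Defs where

open import Data.Nat using (ℕ; zero; suc; _+_; _<ᵇ_)
open import Data.Fin using (Fin; toℕ; punchIn; splitAt; _≟_)
open import Data.Bool using (Bool; true; false; _∧_; _∨_; not; if_then_else_)
open import Data.Sum using (_⊎_; inj₁; inj₂)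
open import Data.Product using (Σ; _×_; _,_; ∃)
open import Relation.Nullary using (¬_)
open import Relation.Nullary.Decidable using (⌊_⌋)
open import Relation.Binary.PropositionalEquality using (_≡_)

_==_ : ∀ {n} → Fin n → Fin n → Bool
i == j = ⌊ i ≟ j ⌋

record Graph : Set where
  constructor mkGraph
  field
    size : ℕ
    adj  : Fin size → Fin size → Bool
open Graph public

IsSimple : Graph → Set
IsSimple G = (∀ i j → adj G i j ≡ adj G j i) × (∀ i → adj G i i ≡ false)

record _≅_ (H G : Graph) : Set where
  field
    to      : Fin (size H) → Fin (size G)
    from    : Fin (size G) → Fin (size H)
    from-to : ∀ i → from (to i) ≡ i
    to-from : ∀ j → to (from j) ≡ j
    pres    : ∀ i j → adj H i j ≡ adj G (to i) (to j)

delete : (n : ℕ) → (Fin (suc n) → Fin (suc n) → Bool) → Fin (suc n) → Graph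
delete n a v = mkGraph n (λ i j → a (punchIn v i) (punchIn v j))

-- Contraction of the edge uv (v is merged into u; v disappears)
contract : (n : ℕ) → (Fin (suc n) → Fin (suc n) → Bool) → (u v : Fin (suc n)) → Graph
contract n a u v = mkGraph n λ i j →
  let i' = punchIn v i ; j' = punchIn v j in
  not (i' == j') ∧ (a i' j' ∨ ((i' == u) ∧ a v j') ∨ ((j' == u) ∧ a v i'))

data _≤IM_ (H : Graph) : Graph → Set where
  iso : ∀ {G} → H ≅ G → H ≤IM G
  del : ∀ n a (v : Fin (suc n)) → H ≤IM delete n a v → H ≤IM mkGraph (suc n) a
  con : ∀ n a (u v : Fin (suc n)) → ¬ (u ≡ v) → a u v ≡ true →
        H ≤IM contract n a u v → H ≤IM mkGraph (suc n) a

K3∪K1 : Graph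
K3∪K1 = mkGraph 4 λ i j → not (i == j) ∧ (toℕ i <ᵇ 3) ∧ (toℕ j <ᵇ 3)

data CWExpr (k : ℕ) : ℕ → Set where
  empty   : CWExpr k 0
  vertex  : Fin k → CWExpr k 1
  union   : ∀ {m n} → CWExpr k m → CWExpr k n → CWExpr k (m + n)
  join    : ∀ {n} (i j : Fin k) → ¬ (i ≡ j) → CWExpr k n → CWExpr k n
  relabel : ∀ {n} (i j : Fin k) → CWExpr k n → CWExpr k n

record LGraph (k n : ℕ) : Set where
  constructor lg
  field
    lab : Fin n → Fin k
    ladj : Fin n → Fin n → Bool

eval : ∀ {k n} → CWExpr k n → LGraph k n
eval empty = lg (λ ()) (λ ())
eval (vertex l) = lg (λ _ → l) (λ _ _ → false)
eval (union {m} {n} e f) with eval e | eval f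
... | lg l₁ a₁ | lg l₂ a₂ = lg lab' adj'
  where
    lab' : Fin (m + n) → _
    lab' x with splitAt m x
    ... | inj₁ y = l₁ y
    ... | inj₂ y = l₂ y
    adj' : Fin (m + n) → Fin (m + n) → Bool
    adj' x y with splitAt m x | splitAt m y
    ... | inj₁ x' | inj₁ y' = a₁ x' y'
    ... | inj₂ x' | inj₂ y' = a₂ x' y'
    ... | _ | _ = false
eval (join i j _ e) with eval e
... | lg l a = lg l (λ x y → a x y ∨ ((l x == i) ∧ (l y == j)) ∨ ((l x == j) ∧ (l y == i)))
eval (relabel i j e) with eval e
... | lg l a = lg (λ x → if l x == i then j else l x) a

graphOf : ∀ {k n} → CWExpr k n → Graph
graphOf {n = n} e = mkGraph n (LGraph.ladj (eval e))

cw≤ : ℕ → Graph → Set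
cw≤ k G = Σ ℕ λ n → Σ (CWExpr k n) λ e → G ≅ graphOf e

BoundedCW : (Graph → Set) → Set
BoundedCW P = Σ ℕ λ c → ∀ G → P G → cw≤ c G

K3∪K1-IMfree : Graph → Set
K3∪K1-IMfree G = IsSimple G × ¬ (K3∪K1 ≤IM G)

-- The complement of K3 ∪ K1 is the claw. Call G co-subcubic claw-free if every vertex has at
-- most three non-neighbours and no three of them are pairwise adjacent. This property passes to
-- induced minors: deletions give induced subgraphs, and after contracting v into u a triangle of
-- non-neighbours of a vertex d either comes from one in G or contains u, in which case v is a
-- fourth non-neighbour of d in G. So these graphs exclude K3 ∪ K1 as an induced minor.
--
-- The complement of a grid in which every node is replaced by two triangles is co-subcubic
-- claw-free. A k-expression for it has a subexpression on a set S of between m and 2m vertices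
-- in which equally labelled vertices have the same neighbours outside S. A vertex of S with a
-- grid neighbour outside S is fixed by its label and by its position relative to its first such
-- neighbour, so there are at most 3k of them. Rows and columns are connected and longer than
-- |S|, so S meets at most 3k rows and 3k columns, whence |S| ≤ 3k · 3k · 6 < m.

module Submission where

open import Defs
open import Data.Nat using (ℕ; zero; suc; _+_; _*_; _∸_; _≡ᵇ_; _≤_; _<_; z≤n; s≤s; s≤s⁻¹; _≤?_)
open import Data.Nat.Properties
  using (≡ᵇ⇒≡; ≤-refl; ≤-trans; <⇒≱; ≰⇒>; +-mono-<; *-mono-≤; m≤m*n; m≤m+n; n≤1+n)
open import Data.Fin
  using (Fin; zero; suc; toℕ; fromℕ; inject₁; inject≤; punchIn; splitAt; _↑ˡ_; _↑ʳ_;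
         combine; remQuot; _≟_)
open import Data.Fin.Properties
  using (any?; ¬∀⟶∃¬; <⇒notInjective; injective⇒≤; 0≢1+n; toℕ≤pred[n]; toℕ-injective;
         inject₁-injective; fromℕ≢inject₁; inject≤-injective; punchIn-injective; punchInᵢ≢i;
         punchOut-injective; splitAt-↑ˡ; splitAt-↑ʳ; splitAt⁻¹-↑ˡ; splitAt⁻¹-↑ʳ; ↑ˡ-injective;
         ↑ʳ-injective; combine-injective; remQuot-combine; combine-remQuot)
open import Data.Bool using (Bool; true; false; _∧_; _∨_; not; if_then_else_; T)
open import Data.Bool.Properties
  using (∨-conicalˡ; ∨-conicalʳ; ∨-identityʳ; ∨-comm; ∧-zeroʳ; not-injective)
  renaming (_≟_ to _≟ᵇ_)
open import Data.Maybe using (Maybe; just; nothing)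
import Data.Maybe as Maybe
open import Data.Maybe.Properties using (just-injective)
open import Data.Sum using (inj₁; inj₂; [_,_]′)
open import Data.Product using (∃; ∃₂; _×_; _,_; proj₁; proj₂)
open import Data.Unit using (tt)
open import Data.Empty using (⊥; ⊥-elim)
open import Data.Vec.Functional using (_∷_)
open import Function using (_∘_; const)
open import Function.Definitions using (Injective)
open import Relation.Nullary using (¬_; yes; no; ¬?; _×-dec_)
open import Relation.Unary using (Decidable)
open import Relation.Binary.PropositionalEquality
open import Relation.Binary.Construct.Closure.ReflexiveTransitive using (Star; ε; _◅_; _◅◅_; reverse)
import Relation.Binary.Construct.Closure.ReflexiveTransitive as Star

==-false : ∀ {n} {i j : Fin n} → i ≢ j → (i == j) ≡ false
==-false {i = i} {j} i≢j with i ≟ j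
... | yes i≡j = ⊥-elim (i≢j i≡j)
... | no _    = refl

==-refl : ∀ {n} (i : Fin n) → (i == i) ≡ true
==-refl i with i ≟ i
... | yes _  = refl
... | no i≢i = ⊥-elim (i≢i refl)

==-sym : ∀ {n} (i j : Fin n) → (i == j) ≡ (j == i)
==-sym i j with i ≟ j | j ≟ i
... | yes _   | yes _   = refl
... | no _    | no _    = refl
... | yes i≡j | no j≢i  = ⊥-elim (j≢i (sym i≡j))
... | no i≢j  | yes j≡i = ⊥-elim (i≢j (sym j≡i))

cons-injective : ∀ {m n} {x : Fin m} {g : Fin n → Fin m} →
                 Injective _≡_ _≡_ g → (∀ t → g t ≢ x) → Injective _≡_ _≡_ (x ∷ g)
cons-injective _     _   {zero}  {zero}  _  = refl
cons-injective _     x∉g {zero}  {suc t} eq = ⊥-elim (x∉g t (sym eq))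
cons-injective _     x∉g {suc s} {zero}  eq = ⊥-elim (x∉g s eq)
cons-injective g-inj _   {suc s} {suc t} eq = cong suc (g-inj eq)

clamp : ∀ n → ℕ → Fin (suc n)
clamp n       zero    = zero
clamp zero    (suc i) = zero
clamp (suc n) (suc i) = suc (clamp n i)

toℕ-clamp : ∀ {n i} → i ≤ n → toℕ (clamp n i) ≡ i
toℕ-clamp {i = zero}  _                 = refl
toℕ-clamp {suc n} {suc i} (s≤s i≤n) = cong suc (toℕ-clamp i≤n)

clamp-toℕ : ∀ {n} (r : Fin (suc n)) → clamp n (toℕ r) ≡ r
clamp-toℕ zero            = refl
clamp-toℕ {suc n} (suc r) = cong suc (clamp-toℕ r)

endo-injective⇒surjective : ∀ {n} {f : Fin n → Fin n} →
                            Injective _≡_ _≡_ f → ∀ i → ∃ λ t → f t ≡ i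
endo-injective⇒surjective {suc n} {f} f-inj i with any? (λ t → f t ≟ i)
... | yes hit = hit
... | no miss =
  ⊥-elim (<⇒notInjective ≤-refl λ {s} {t} → f-inj ∘ punchOut-injective (avoids s) (avoids t))
  where
    avoids : ∀ t → i ≢ f t
    avoids t i≡ft = miss (t , sym i≡ft)

module _ {A : Set} {R : A → A → Set} {P : A → Set} (P? : Decidable P) where

  crossing : ∀ {x y} → Star R x y → P x → ¬ P y → ∃₂ λ b z → R b z × P b × ¬ P z
  crossing ε px ¬py = ⊥-elim (¬py px)
  crossing {x} (_◅_ {j = w} r rs) px ¬py with P? w
  ... | yes pw = crossing rs pw ¬py
  ... | no ¬pw = x , w , r , px , ¬pw

first : ∀ {n} {P : Fin n → Set} → Decidable P → Maybe (Fin n)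
first {zero}  _  = nothing
first {suc n} P? with P? zero
... | yes _ = just zero
... | no  _ = Maybe.map suc (first (P? ∘ suc))

first-complete : ∀ {n} {P : Fin n → Set} (P? : Decidable P) {i} →
                 P i → ∃ λ j → first P? ≡ just j × P j
first-complete {suc n} P? {i} pi with P? zero | i
... | yes p0  | _     = zero , refl , p0
... | no ¬p0  | zero  = ⊥-elim (¬p0 pi)
... | no _    | suc _ with first-complete (P? ∘ suc) pi
...   | j , first≡j , pj = suc j , cong (Maybe.map suc) first≡j , pj

first-cong : ∀ {n} {P Q : Fin n → Set} (P? : Decidable P) (Q? : Decidable Q) →
             (∀ i → P i → Q i) → (∀ i → Q i → P i) → first P? ≡ first Q?
first-cong {zero}  _  _  _   _   = refl
first-cong {suc n} P? Q? P⇒Q Q⇒P with P? zero | Q? zero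
... | yes _  | yes _  = refl
... | no _   | no _   =
  cong (Maybe.map suc) (first-cong (P? ∘ suc) (Q? ∘ suc) (P⇒Q ∘ suc) (Q⇒P ∘ suc))
... | yes p  | no ¬q  = ⊥-elim (¬q (P⇒Q zero p))
... | no ¬p  | yes q  = ⊥-elim (¬p (Q⇒P zero q))

record ImageEnumeration {n r} (f : Fin n → Fin r) : Set where
  field
    count        : ℕ
    rep          : Fin count → Fin n
    rep-distinct : Injective _≡_ _≡_ (f ∘ rep)
    index        : Fin n → Fin count
    index-sound  : ∀ a → f (rep (index a)) ≡ f a

enumerateImage : ∀ {n r} (f : Fin n → Fin r) → ImageEnumeration f
enumerateImage {zero} f = record
  { count = 0 ; rep = λ () ; rep-distinct = λ {} ; index = λ () ; index-sound = λ () }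
enumerateImage {suc n} f with enumerateImage (f ∘ suc)
... | record { count = b ; rep = rep ; rep-distinct = distinct ; index = index ; index-sound = sound }
  with any? (λ t → f (suc (rep t)) ≟ f zero)
...   | yes (t , hit) = record
  { count = b ; rep = suc ∘ rep ; rep-distinct = distinct
  ; index = λ { zero → t ; (suc a) → index a }
  ; index-sound = λ { zero → hit ; (suc a) → sound a } }
...   | no miss = record
  { count = suc b
  ; rep = λ { zero → zero ; (suc t) → suc (rep t) }
  ; rep-distinct = λ { {zero} {zero} _ → refl
                     ; {zero} {suc t} eq → ⊥-elim (miss (t , sym eq))
                     ; {suc t} {zero} eq → ⊥-elim (miss (t , eq))
                     ; {suc t} {suc t'} eq → cong suc (distinct eq) }
  ; index = λ { zero → zero ; (suc a) → suc (index a) }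
  ; index-sound = λ { zero → refl ; (suc a) → sound a } }

-- Co-subcubic claw-free graphs and induced minors

Adjacency : ℕ → Set
Adjacency n = Fin n → Fin n → Bool

module _ {n : ℕ} (a : Adjacency n) where

  NonNeighbour : Fin n → Fin n → Set
  NonNeighbour d x = x ≢ d × a d x ≡ false

  CoDegree≤3 : Set
  CoDegree≤3 = ∀ d (f : Fin 4 → Fin n) → Injective _≡_ _≡_ f → (∀ t → NonNeighbour d (f t)) → ⊥

  CoClawFree : Set
  CoClawFree = ∀ d (f : Fin 3 → Fin n) → Injective _≡_ _≡_ f → (∀ t → NonNeighbour d (f t)) →
               (∀ s t → s ≢ t → a (f s) (f t) ≡ true) → ⊥

record CoSubcubicClawFree (G : Graph) : Set where
  field
    adj-sym    : ∀ i j → adj G i j ≡ adj G j i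
    coDegree≤3 : CoDegree≤3 (adj G)
    coClawFree : CoClawFree (adj G)

module _ {m n} {a : Adjacency m} {b : Adjacency n} {f : Fin n → Fin m}
         (f-inj : Injective _≡_ _≡_ f) where

  private
    f-≢ : ∀ {i j} → i ≢ j → f i ≢ f j
    f-≢ i≢j = i≢j ∘ f-inj

  coDegree≤3-pullback : (∀ d x → x ≢ d → b d x ≡ false → a (f d) (f x) ≡ false) →
                        CoDegree≤3 a → CoDegree≤3 b
  coDegree≤3-pullback reflect degree d g g-inj nonNbr =
    degree (f d) (f ∘ g) (g-inj ∘ f-inj) λ t →
      f-≢ (proj₁ (nonNbr t)) , reflect d (g t) (proj₁ (nonNbr t)) (proj₂ (nonNbr t))

  coClawFree-pullback : (∀ i j → b i j ≡ a (f i) (f j)) → CoClawFree a → CoClawFree b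
  coClawFree-pullback b≡a∘f claw d g g-inj nonNbr leaves =
    claw (f d) (f ∘ g) (g-inj ∘ f-inj)
      (λ t → f-≢ (proj₁ (nonNbr t)) , trans (sym (b≡a∘f d (g t))) (proj₂ (nonNbr t)))
      (λ s t s≢t → trans (sym (b≡a∘f (g s) (g t))) (leaves s t s≢t))

record _↪_ (H G : Graph) : Set where
  field
    embed           : Fin (size H) → Fin (size G)
    embed-injective : Injective _≡_ _≡_ embed
    adj-embed       : ∀ i j → adj H i j ≡ adj G (embed i) (embed j)

≅⇒↪ : ∀ {H G} → H ≅ G → H ↪ G
≅⇒↪ H≅G = record
  { embed           = to
  ; embed-injective = λ {i} {j} eq → trans (sym (from-to i)) (trans (cong from eq) (from-to j))
  ; adj-embed       = pres
  }
  where open _≅_ H≅G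

delete↪ : ∀ n a v → delete n a v ↪ mkGraph (suc n) a
delete↪ n a v = record
  { embed           = punchIn v
  ; embed-injective = punchIn-injective v _ _
  ; adj-embed       = λ _ _ → refl
  }

coSubcubicClawFree-↪ : ∀ {H G} → H ↪ G → CoSubcubicClawFree G → CoSubcubicClawFree H
coSubcubicClawFree-↪ {H} {G} H↪G inv = record
  { adj-sym    = λ i j → trans (adj-embed i j) (trans (adj-sym (embed i) (embed j)) (sym (adj-embed j i)))
  ; coDegree≤3 = coDegree≤3-pullback {a = adj G} {b = adj H} embed-injective
                   (λ d x _ bdx → trans (sym (adj-embed d x)) bdx) coDegree≤3
  ; coClawFree = coClawFree-pullback {a = adj G} {b = adj H} embed-injective adj-embed coClawFree
  }
  where
    open _↪_ H↪G
    open CoSubcubicClawFree inv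

module Contraction {n} (a : Adjacency (suc n)) (u v : Fin (suc n)) where

  private
    p = punchIn v
    c = adj (contract n a u v)

  contract-unfold : ∀ {i j} → i ≢ j →
    c i j ≡ a (p i) (p j) ∨ ((p i == u) ∧ a v (p j)) ∨ ((p j == u) ∧ a v (p i))
  contract-unfold {i} {j} i≢j rewrite ==-false (i≢j ∘ punchIn-injective v i j) = refl

  contract-sym : (∀ x y → a x y ≡ a y x) → ∀ i j → c i j ≡ c j i
  contract-sym a-sym i j with i ≟ j
  ... | yes refl = refl
  ... | no i≢j = begin
    c i j                        ≡⟨ contract-unfold i≢j ⟩
    a (p i) (p j) ∨ viaˡ ∨ viaʳ  ≡⟨ cong₂ _∨_ (a-sym (p i) (p j)) (∨-comm viaˡ viaʳ) ⟩
    a (p j) (p i) ∨ viaʳ ∨ viaˡ  ≡⟨ contract-unfold (i≢j ∘ sym) ⟨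
    c j i                        ∎
    where
      open ≡-Reasoning
      viaˡ = (p i == u) ∧ a v (p j)
      viaʳ = (p j == u) ∧ a v (p i)

  contract-nonadj : ∀ {i j} → j ≢ i → c i j ≡ false → a (p i) (p j) ≡ false
  contract-nonadj j≢i cij = ∨-conicalˡ _ _ (trans (sym (contract-unfold (j≢i ∘ sym))) cij)

  contract-nonadj-via : ∀ {i j} → j ≢ i → c i j ≡ false → p j ≡ u → a v (p i) ≡ false
  contract-nonadj-via {i} {j} j≢i cij pj≡u =
    trans (cong (_∧ a v (p i)) (sym pj==u))
          (∨-conicalʳ ((p i == u) ∧ a v (p j)) _ (∨-conicalʳ (a (p i) (p j)) _ unfolded))
    where
      unfolded = trans (sym (contract-unfold (j≢i ∘ sym))) cij
      pj==u : (p j == u) ≡ true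
      pj==u = trans (cong (_== u) pj≡u) (==-refl u)

  contract-adj : ∀ {i j} → i ≢ j → p i ≢ u → p j ≢ u → c i j ≡ true → a (p i) (p j) ≡ true
  contract-adj {i} {j} i≢j pi≢u pj≢u cij = begin
    a (p i) (p j)               ≡⟨ ∨-identityʳ _ ⟨
    unfolded false false        ≡⟨ cong₂ unfolded (==-false pi≢u) (==-false pj≢u) ⟨
    unfolded (p i == u) (p j == u) ≡⟨ contract-unfold i≢j ⟨
    c i j                       ≡⟨ cij ⟩
    true                        ∎
    where
      open ≡-Reasoning
      unfolded : Bool → Bool → Bool
      unfolded x y = a (p i) (p j) ∨ x ∧ a v (p j) ∨ y ∧ a v (p i)

  nonNeighbour-lift : ∀ {d x} → NonNeighbour c d x → NonNeighbour a (p d) (p x)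
  nonNeighbour-lift (x≢d , cdx) = x≢d ∘ punchIn-injective v _ _ , contract-nonadj x≢d cdx

  module _ (a-sym : ∀ x y → a x y ≡ a y x) where

    coDegree≤3-contract : CoDegree≤3 a → CoDegree≤3 c
    coDegree≤3-contract =
      coDegree≤3-pullback {a = a} {b = c} (punchIn-injective v _ _) λ d x x≢d → contract-nonadj x≢d

    -- A leaf merged into u makes v a fourth non-neighbour of the centre.
    coClawFree-contract : CoDegree≤3 a → CoClawFree a → CoClawFree c
    coClawFree-contract degree claw d f f-inj nonNbr leaves with any? (λ t → p (f t) ≟ u)
    ... | yes (t , pft≡u) =
      degree (p d) (v ∷ p ∘ f) (cons-injective (f-inj ∘ punchIn-injective v _ _) (punchInᵢ≢i v ∘ f))
        λ { zero    → punchInᵢ≢i v d ∘ sym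
                    , trans (a-sym (p d) v) (contract-nonadj-via (proj₁ (nonNbr t)) (proj₂ (nonNbr t)) pft≡u)
          ; (suc s) → nonNeighbour-lift (nonNbr s) }
    ... | no none =
      claw (p d) (p ∘ f) (f-inj ∘ punchIn-injective v _ _) (nonNeighbour-lift ∘ nonNbr)
        (λ s t s≢t → contract-adj (s≢t ∘ f-inj) (none ∘ (s ,_)) (none ∘ (t ,_)) (leaves s t s≢t))

coSubcubicClawFree-contract : ∀ n a u v →
  CoSubcubicClawFree (mkGraph (suc n) a) → CoSubcubicClawFree (contract n a u v)
coSubcubicClawFree-contract n a u v inv = record
  { adj-sym    = contract-sym adj-sym
  ; coDegree≤3 = coDegree≤3-contract adj-sym coDegree≤3
  ; coClawFree = coClawFree-contract adj-sym coDegree≤3 coClawFree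
  }
  where
    open Contraction a u v
    open CoSubcubicClawFree inv

coSubcubicClawFree-≤IM : ∀ {H G} → H ≤IM G → CoSubcubicClawFree G → CoSubcubicClawFree H
coSubcubicClawFree-≤IM (iso H≅G) = coSubcubicClawFree-↪ (≅⇒↪ H≅G)
coSubcubicClawFree-≤IM (del n a v H≤G) =
  coSubcubicClawFree-≤IM H≤G ∘ coSubcubicClawFree-↪ (delete↪ n a v)
coSubcubicClawFree-≤IM (con n a u v _ _ H≤G) =
  coSubcubicClawFree-≤IM H≤G ∘ coSubcubicClawFree-contract n a u v

-- The complement of K3 ∪ K1 is a claw centred at the isolated vertex.
K3∪K1-not-coClawFree : ¬ CoClawFree (adj K3∪K1)
K3∪K1-not-coClawFree claw =
  claw (fromℕ 3) inject₁ inject₁-injective (λ t → fromℕ≢inject₁ ∘ sym , ∧-zeroʳ _) triangle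
  where
    triangle : ∀ s t → s ≢ t → adj K3∪K1 (inject₁ s) (inject₁ t) ≡ true
    triangle zero                zero                s≢s = ⊥-elim (s≢s refl)
    triangle zero                (suc zero)          _   = refl
    triangle zero                (suc (suc zero))    _   = refl
    triangle (suc zero)          zero                _   = refl
    triangle (suc zero)          (suc zero)          s≢s = ⊥-elim (s≢s refl)
    triangle (suc zero)          (suc (suc zero))    _   = refl
    triangle (suc (suc zero))    zero                _   = refl
    triangle (suc (suc zero))    (suc zero)          _   = refl
    triangle (suc (suc zero))    (suc (suc zero))    s≢s = ⊥-elim (s≢s refl)

coSubcubicClawFree⇒K3∪K1-free : ∀ {G} → CoSubcubicClawFree G → ¬ (K3∪K1 ≤IM G)
coSubcubicClawFree⇒K3∪K1-free inv K≤G =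
  K3∪K1-not-coClawFree (CoSubcubicClawFree.coClawFree (coSubcubicClawFree-≤IM K≤G inv))

-- Subexpressions of clique-width expressions

module _ {k : ℕ} where

  lab⟦_⟧ : ∀ {n} → CWExpr k n → Fin n → Fin k
  lab⟦ e ⟧ = LGraph.lab (eval e)

  adj⟦_⟧ : ∀ {n} → CWExpr k n → Adjacency n
  adj⟦ e ⟧ = LGraph.ladj (eval e)

  module _ {m q} (e : CWExpr k m) (f : CWExpr k q) where

    lab⟦union⟧-↑ˡ : ∀ x → lab⟦ union e f ⟧ (x ↑ˡ q) ≡ lab⟦ e ⟧ x
    lab⟦union⟧-↑ˡ x with eval e | eval f
    ... | lg _ _ | lg _ _ rewrite splitAt-↑ˡ m x q = refl

    lab⟦union⟧-↑ʳ : ∀ x → lab⟦ union e f ⟧ (m ↑ʳ x) ≡ lab⟦ f ⟧ x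
    lab⟦union⟧-↑ʳ x with eval e | eval f
    ... | lg _ _ | lg _ _ rewrite splitAt-↑ʳ m q x = refl

    adj⟦union⟧-↑ˡ : ∀ x z →
                    adj⟦ union e f ⟧ (x ↑ˡ q) z ≡ [ adj⟦ e ⟧ x , const false ]′ (splitAt m z)
    adj⟦union⟧-↑ˡ x z with eval e | eval f
    ... | lg _ _ | lg _ _ rewrite splitAt-↑ˡ m x q with splitAt m z
    ...   | inj₁ _ = refl
    ...   | inj₂ _ = refl

    adj⟦union⟧-↑ʳ : ∀ x z →
                    adj⟦ union e f ⟧ (m ↑ʳ x) z ≡ [ const false , adj⟦ f ⟧ x ]′ (splitAt m z)
    adj⟦union⟧-↑ʳ x z with eval e | eval f
    ... | lg _ _ | lg _ _ rewrite splitAt-↑ʳ m q x with splitAt m z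
    ...   | inj₁ _ = refl
    ...   | inj₂ _ = refl

  module _ {n} (i j : Fin k) (i≢j : i ≢ j) (e : CWExpr k n) where

    lab⟦join⟧ : ∀ x → lab⟦ join i j i≢j e ⟧ x ≡ lab⟦ e ⟧ x
    lab⟦join⟧ x with eval e
    ... | lg _ _ = refl

    adj⟦join⟧ : ∀ x y → adj⟦ join i j i≢j e ⟧ x y ≡
      adj⟦ e ⟧ x y ∨ ((lab⟦ e ⟧ x == i) ∧ (lab⟦ e ⟧ y == j))
                   ∨ ((lab⟦ e ⟧ x == j) ∧ (lab⟦ e ⟧ y == i))
    adj⟦join⟧ x y with eval e
    ... | lg _ _ = refl

  module _ {n} (i j : Fin k) (e : CWExpr k n) where

    lab⟦relabel⟧ : ∀ x →
                   lab⟦ relabel i j e ⟧ x ≡ (if lab⟦ e ⟧ x == i then j else lab⟦ e ⟧ x)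
    lab⟦relabel⟧ x with eval e
    ... | lg _ _ = refl

    adj⟦relabel⟧ : ∀ x y → adj⟦ relabel i j e ⟧ x y ≡ adj⟦ e ⟧ x y
    adj⟦relabel⟧ x y with eval e
    ... | lg _ _ = refl

OutsideTwins : ∀ {k n s} → CWExpr k n → (Fin s → Fin n) → (Fin s → Fin k) → Set
OutsideTwins e ι L = ∀ x y → L x ≡ L y →
  lab⟦ e ⟧ (ι x) ≡ lab⟦ e ⟧ (ι y) ×
  (∀ z → (∀ w → ι w ≢ z) → adj⟦ e ⟧ (ι x) z ≡ adj⟦ e ⟧ (ι y) z)

-- The vertices of a subexpression of e, labelled as in that subexpression.
record Piece {k n} (e : CWExpr k n) (m : ℕ) : Set where
  field
    card            : ℕ
    m≤card          : m ≤ card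
    card<2m         : card < m + m
    embed           : Fin card → Fin n
    embed-injective : Injective _≡_ _≡_ embed
    label           : Fin card → Fin k
    twins           : OutsideTwins e embed label

module _ {k m q} (e : CWExpr k m) (f : CWExpr k q) {s} {L : Fin s → Fin k} where

  twins-unionˡ : ∀ {ι : Fin s → Fin m} →
                 OutsideTwins e ι L → OutsideTwins (union e f) (λ x → ι x ↑ˡ q) L
  twins-unionˡ {ι} twins x y Lx≡Ly = lab≡ , adj≡
    where
      lab≡ = trans (lab⟦union⟧-↑ˡ e f (ι x))
                   (trans (proj₁ (twins x y Lx≡Ly)) (sym (lab⟦union⟧-↑ˡ e f (ι y))))
      adj≡ : ∀ z → (∀ w → ι w ↑ˡ q ≢ z) →
             adj⟦ union e f ⟧ (ι x ↑ˡ q) z ≡ adj⟦ union e f ⟧ (ι y ↑ˡ q) z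
      adj≡ z outside rewrite adj⟦union⟧-↑ˡ e f (ι x) z | adj⟦union⟧-↑ˡ e f (ι y) z
        with splitAt m z in eq
      ... | inj₁ z₁ = proj₂ (twins x y Lx≡Ly) z₁ λ w ιw≡z₁ →
                        outside w (trans (cong (_↑ˡ q) ιw≡z₁) (splitAt⁻¹-↑ˡ eq))
      ... | inj₂ _  = refl

  twins-unionʳ : ∀ {ι : Fin s → Fin q} →
                 OutsideTwins f ι L → OutsideTwins (union e f) (λ x → m ↑ʳ ι x) L
  twins-unionʳ {ι} twins x y Lx≡Ly = lab≡ , adj≡
    where
      lab≡ = trans (lab⟦union⟧-↑ʳ e f (ι x))
                   (trans (proj₁ (twins x y Lx≡Ly)) (sym (lab⟦union⟧-↑ʳ e f (ι y))))
      adj≡ : ∀ z → (∀ w → m ↑ʳ ι w ≢ z) →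
             adj⟦ union e f ⟧ (m ↑ʳ ι x) z ≡ adj⟦ union e f ⟧ (m ↑ʳ ι y) z
      adj≡ z outside rewrite adj⟦union⟧-↑ʳ e f (ι x) z | adj⟦union⟧-↑ʳ e f (ι y) z
        with splitAt m z in eq
      ... | inj₁ _  = refl
      ... | inj₂ z₂ = proj₂ (twins x y Lx≡Ly) z₂ λ w ιw≡z₂ →
                        outside w (trans (cong (m ↑ʳ_) ιw≡z₂) (splitAt⁻¹-↑ʳ eq))

module _ {k n s} {ι : Fin s → Fin n} {L : Fin s → Fin k} (e : CWExpr k n) where

  twins-join : ∀ i j i≢j → OutsideTwins e ι L → OutsideTwins (join i j i≢j e) ι L
  twins-join i j i≢j twins x y Lx≡Ly =
    trans (lab⟦join⟧ i j i≢j e (ι x)) (trans lab≡ (sym (lab⟦join⟧ i j i≢j e (ι y)))) ,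
    λ z outside → trans (adj⟦join⟧ i j i≢j e (ι x) z)
      (trans (cong₂ (λ b l → b ∨ ((l == i) ∧ (lab⟦ e ⟧ z == j)) ∨ ((l == j) ∧ (lab⟦ e ⟧ z == i)))
                    (adj≡ z outside) lab≡)
             (sym (adj⟦join⟧ i j i≢j e (ι y) z)))
    where
      lab≡ = proj₁ (twins x y Lx≡Ly)
      adj≡ = proj₂ (twins x y Lx≡Ly)

  twins-relabel : ∀ i j → OutsideTwins e ι L → OutsideTwins (relabel i j e) ι L
  twins-relabel i j twins x y Lx≡Ly =
    trans (lab⟦relabel⟧ i j e (ι x))
      (trans (cong (λ l → if l == i then j else l) (proj₁ (twins x y Lx≡Ly)))
             (sym (lab⟦relabel⟧ i j e (ι y)))) ,
    λ z outside → trans (adj⟦relabel⟧ i j e (ι x) z)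
      (trans (proj₂ (twins x y Lx≡Ly) z outside) (sym (adj⟦relabel⟧ i j e (ι y) z)))

module _ {k n} {e : CWExpr k n} {s} (P : Piece e s) where
  open Piece P

  piece-unionˡ : ∀ {q} (f : CWExpr k q) → Piece (union e f) s
  piece-unionˡ {q} f = record
    { card = card ; m≤card = m≤card ; card<2m = card<2m
    ; embed = λ x → embed x ↑ˡ q ; embed-injective = embed-injective ∘ ↑ˡ-injective q _ _
    ; label = label ; twins = twins-unionˡ e f twins }

  piece-unionʳ : ∀ {p} (d : CWExpr k p) → Piece (union d e) s
  piece-unionʳ {p} d = record
    { card = card ; m≤card = m≤card ; card<2m = card<2m
    ; embed = λ x → p ↑ʳ embed x ; embed-injective = embed-injective ∘ ↑ʳ-injective p _ _
    ; label = label ; twins = twins-unionʳ d e twins }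

  piece-join : ∀ i j i≢j → Piece (join i j i≢j e) s
  piece-join i j i≢j = record
    { card = card ; m≤card = m≤card ; card<2m = card<2m
    ; embed = embed ; embed-injective = embed-injective
    ; label = label ; twins = twins-join e i j i≢j twins }

  piece-relabel : ∀ i j → Piece (relabel i j e) s
  piece-relabel i j = record
    { card = card ; m≤card = m≤card ; card<2m = card<2m
    ; embed = embed ; embed-injective = embed-injective
    ; label = label ; twins = twins-relabel e i j twins }

-- Descend while the expression has at least 2m vertices: a union that large has an argument
-- with at least m vertices.
piece : ∀ {k n} (e : CWExpr k n) {m} → 1 ≤ m → m ≤ n → Piece e m
piece {n = n} e {m} 1≤m m≤n with m + m ≤? n
... | no n<2m = record
  { card = n ; m≤card = m≤n ; card<2m = ≰⇒> n<2m
  ; embed = λ x → x ; embed-injective = λ eq → eq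
  ; label = lab⟦ e ⟧ ; twins = λ x y lab≡ → lab≡ , λ z outside → ⊥-elim (outside z refl) }
piece empty (s≤s _) () | yes _
piece (vertex _) {suc zero} _ _ | yes (s≤s ())
piece (vertex _) {suc (suc _)} _ _ | yes (s≤s ())
piece (union {p} {q} e f) {m} 1≤m _ | yes 2m≤p+q with m ≤? p | m ≤? q
... | yes m≤p | _       = piece-unionˡ (piece e 1≤m m≤p) f
... | no _    | yes m≤q = piece-unionʳ (piece f 1≤m m≤q) e
... | no p<m  | no q<m  = ⊥-elim (<⇒≱ (+-mono-< (≰⇒> p<m) (≰⇒> q<m)) 2m≤p+q)
piece (join i j i≢j e) 1≤m m≤n | yes _ = piece-join (piece e 1≤m m≤n) i j i≢j
piece (relabel i j e) 1≤m m≤n | yes _ = piece-relabel (piece e 1≤m m≤n) i j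

-- The grid of triangle pairs

pattern p₀ = zero
pattern p₁ = suc zero
pattern p₂ = suc (suc zero)
pattern p₃ = suc (suc (suc zero))
pattern p₄ = suc (suc (suc (suc zero)))
pattern p₅ = suc (suc (suc (suc (suc zero))))

-- (row, column, corner): each cell consists of the triangles 012 and 345 joined by the
-- edge 23; corner 4 is joined to corner 0 of the next cell in its row and corner 5 to
-- corner 1 of the next cell in its column.
Coord : Set
Coord = ℕ × ℕ × Fin 6

data EdgeKind : Set where
  inner horizontal vertical none : EdgeKind

edgeKind : Fin 6 → Fin 6 → EdgeKind
edgeKind p₀ p₁ = inner
edgeKind p₀ p₂ = inner
edgeKind p₁ p₂ = inner
edgeKind p₂ p₃ = inner
edgeKind p₃ p₄ = inner
edgeKind p₃ p₅ = inner
edgeKind p₄ p₅ = inner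
edgeKind p₄ p₀ = horizontal
edgeKind p₅ p₁ = vertical
edgeKind _  _  = none

cellStep : EdgeKind → ℕ → ℕ → ℕ → ℕ → Bool
cellStep inner      i j i' j' = (i ≡ᵇ i') ∧ (j ≡ᵇ j')
cellStep horizontal i j i' j' = (i ≡ᵇ i') ∧ (j' ≡ᵇ suc j)
cellStep vertical   i j i' j' = (j ≡ᵇ j') ∧ (i' ≡ᵇ suc i)
cellStep none       i j i' j' = false

arc : Coord → Coord → Bool
arc (i , j , p) (i' , j' , p') = cellStep (edgeKind p p') i j i' j'

gridAdj : Coord → Coord → Bool
gridAdj c c' = arc c c' ∨ arc c' c

gridAdj-sym : ∀ c c' → gridAdj c c' ≡ gridAdj c' c
gridAdj-sym c c' = ∨-comm (arc c c') (arc c' c)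

≡ᵇ-refl : ∀ n → (n ≡ᵇ n) ≡ true
≡ᵇ-refl zero    = refl
≡ᵇ-refl (suc n) = ≡ᵇ-refl n

cellAdj : ∀ i j p q → edgeKind p q ≡ inner → gridAdj (i , j , p) (i , j , q) ≡ true
cellAdj i j p q k rewrite k | ≡ᵇ-refl i | ≡ᵇ-refl j = refl

rowAdj : ∀ i j → gridAdj (i , j , p₄) (i , suc j , p₀) ≡ true
rowAdj i j rewrite ≡ᵇ-refl i | ≡ᵇ-refl j = refl

colAdj : ∀ i j → gridAdj (i , j , p₅) (suc i , j , p₁) ≡ true
colAdj i j rewrite ≡ᵇ-refl i | ≡ᵇ-refl j = refl

mateˡ mateʳ : Fin 6 → Fin 6
mateˡ p₀ = p₁
mateˡ p₁ = p₀
mateˡ p₂ = p₀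
mateˡ p₃ = p₄
mateˡ p₄ = p₃
mateˡ p₅ = p₃
mateʳ p₀ = p₂
mateʳ p₁ = p₂
mateʳ p₂ = p₁
mateʳ p₃ = p₅
mateʳ p₄ = p₅
mateʳ p₅ = p₄

bridgeNbr : Coord → Coord
bridgeNbr (i , j , p₀) = i , j ∸ 1 , p₄
bridgeNbr (i , j , p₁) = i ∸ 1 , j , p₅
bridgeNbr (i , j , p₂) = i , j , p₃
bridgeNbr (i , j , p₃) = i , j , p₂
bridgeNbr (i , j , p₄) = i , suc j , p₀
bridgeNbr (i , j , p₅) = suc i , j , p₁

-- The two triangle mates of a corner and the corner across its bridge (junk at the border of
-- the grid, where the bridge is missing).
gridNbr : Coord → Fin 3 → Coord
gridNbr (i , j , p) zero             = i , j , mateˡ p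
gridNbr (i , j , p) (suc zero)       = i , j , mateʳ p
gridNbr c           (suc (suc zero)) = bridgeNbr c

mates-adj : ∀ c → gridAdj (gridNbr c zero) (gridNbr c (suc zero)) ≡ true
mates-adj (i , j , p₀) = cellAdj i j p₁ p₂ refl
mates-adj (i , j , p₁) = cellAdj i j p₀ p₂ refl
mates-adj (i , j , p₂) = cellAdj i j p₀ p₁ refl
mates-adj (i , j , p₃) = cellAdj i j p₄ p₅ refl
mates-adj (i , j , p₄) = cellAdj i j p₃ p₅ refl
mates-adj (i , j , p₅) = cellAdj i j p₃ p₄ refl

-- Coordinates of an edge read off from gridAdj c c' = arc c c' ∨ arc c' c, of which one arc
-- has already reduced to false: arc c' c for the lemmas marked →, arc c c' for those marked ←.
private
  ≡ᵇ⇒≡′ : ∀ {m n} → (m ≡ᵇ n) ≡ true → m ≡ n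
  ≡ᵇ⇒≡′ {m} {n} e = ≡ᵇ⇒≡ m n (subst T (sym e) tt)

  ∧-true : ∀ x y → x ∧ y ≡ true → x ≡ true × y ≡ true
  ∧-true true true _ = refl , refl

  ∧∨false-true : ∀ x y → x ∧ y ∨ false ≡ true → x ≡ true × y ≡ true
  ∧∨false-true x y e = ∧-true x y (trans (sym (∨-identityʳ (x ∧ y))) e)

  coord≡ : ∀ {i j i' j' : ℕ} {p : Fin 6} → i ≡ i' → j ≡ j' → (i , j , p) ≡ (i' , j' , p)
  coord≡ refl refl = refl

  inner→ : ∀ i j i' j' {p} → (i ≡ᵇ i') ∧ (j ≡ᵇ j') ∨ false ≡ true →
           (i , j , p) ≡ (i' , j' , p)
  inner→ i j i' j' e with ∧∨false-true (i ≡ᵇ i') (j ≡ᵇ j') e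
  ... | i≡ , j≡ = coord≡ (≡ᵇ⇒≡′ i≡) (≡ᵇ⇒≡′ j≡)

  inner← : ∀ i j i' j' {p} → (i' ≡ᵇ i) ∧ (j' ≡ᵇ j) ≡ true → (i , j , p) ≡ (i' , j' , p)
  inner← i j i' j' e with ∧-true (i' ≡ᵇ i) (j' ≡ᵇ j) e
  ... | i≡ , j≡ = coord≡ (sym (≡ᵇ⇒≡′ i≡)) (sym (≡ᵇ⇒≡′ j≡))

  row→ : ∀ i j i' j' {p} → (i ≡ᵇ i') ∧ (j' ≡ᵇ suc j) ∨ false ≡ true →
         (i , suc j , p) ≡ (i' , j' , p)
  row→ i j i' j' e with ∧∨false-true (i ≡ᵇ i') (j' ≡ᵇ suc j) e
  ... | i≡ , j≡ = coord≡ (≡ᵇ⇒≡′ i≡) (sym (≡ᵇ⇒≡′ j≡))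

  row← : ∀ i j i' j' {p} → (i' ≡ᵇ i) ∧ (j ≡ᵇ suc j') ≡ true → (i , j ∸ 1 , p) ≡ (i' , j' , p)
  row← i j i' j' e with ∧-true (i' ≡ᵇ i) (j ≡ᵇ suc j') e
  ... | i≡ , j≡ = coord≡ (sym (≡ᵇ⇒≡′ i≡)) (cong (_∸ 1) (≡ᵇ⇒≡′ {j} {suc j'} j≡))

  col→ : ∀ i j i' j' {p} → (j ≡ᵇ j') ∧ (i' ≡ᵇ suc i) ∨ false ≡ true →
         (suc i , j , p) ≡ (i' , j' , p)
  col→ i j i' j' e with ∧∨false-true (j ≡ᵇ j') (i' ≡ᵇ suc i) e
  ... | j≡ , i≡ = coord≡ (sym (≡ᵇ⇒≡′ i≡)) (≡ᵇ⇒≡′ j≡)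

  col← : ∀ i j i' j' {p} → (j' ≡ᵇ j) ∧ (i ≡ᵇ suc i') ≡ true → (i ∸ 1 , j , p) ≡ (i' , j' , p)
  col← i j i' j' e with ∧-true (j' ≡ᵇ j) (i ≡ᵇ suc i') e
  ... | j≡ , i≡ = coord≡ (cong (_∸ 1) (≡ᵇ⇒≡′ {i} {suc i'} i≡)) (sym (≡ᵇ⇒≡′ j≡))

gridAdj⇒nbr : ∀ c c' → gridAdj c c' ≡ true → ∃ λ d → gridNbr c d ≡ c'
gridAdj⇒nbr (i , j , p₀) (i' , j' , p₀) ()
gridAdj⇒nbr (i , j , p₀) (i' , j' , p₁) e = zero , inner→ i j i' j' e
gridAdj⇒nbr (i , j , p₀) (i' , j' , p₂) e = suc zero , inner→ i j i' j' e
gridAdj⇒nbr (i , j , p₀) (i' , j' , p₃) ()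
gridAdj⇒nbr (i , j , p₀) (i' , j' , p₄) e = suc (suc zero) , row← i j i' j' e
gridAdj⇒nbr (i , j , p₀) (i' , j' , p₅) ()
gridAdj⇒nbr (i , j , p₁) (i' , j' , p₀) e = zero , inner← i j i' j' e
gridAdj⇒nbr (i , j , p₁) (i' , j' , p₁) ()
gridAdj⇒nbr (i , j , p₁) (i' , j' , p₂) e = suc zero , inner→ i j i' j' e
gridAdj⇒nbr (i , j , p₁) (i' , j' , p₃) ()
gridAdj⇒nbr (i , j , p₁) (i' , j' , p₄) ()
gridAdj⇒nbr (i , j , p₁) (i' , j' , p₅) e = suc (suc zero) , col← i j i' j' e
gridAdj⇒nbr (i , j , p₂) (i' , j' , p₀) e = zero , inner← i j i' j' e
gridAdj⇒nbr (i , j , p₂) (i' , j' , p₁) e = suc zero , inner← i j i' j' e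
gridAdj⇒nbr (i , j , p₂) (i' , j' , p₂) ()
gridAdj⇒nbr (i , j , p₂) (i' , j' , p₃) e = suc (suc zero) , inner→ i j i' j' e
gridAdj⇒nbr (i , j , p₂) (i' , j' , p₄) ()
gridAdj⇒nbr (i , j , p₂) (i' , j' , p₅) ()
gridAdj⇒nbr (i , j , p₃) (i' , j' , p₀) ()
gridAdj⇒nbr (i , j , p₃) (i' , j' , p₁) ()
gridAdj⇒nbr (i , j , p₃) (i' , j' , p₂) e = suc (suc zero) , inner← i j i' j' e
gridAdj⇒nbr (i , j , p₃) (i' , j' , p₃) ()
gridAdj⇒nbr (i , j , p₃) (i' , j' , p₄) e = zero , inner→ i j i' j' e
gridAdj⇒nbr (i , j , p₃) (i' , j' , p₅) e = suc zero , inner→ i j i' j' e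
gridAdj⇒nbr (i , j , p₄) (i' , j' , p₀) e = suc (suc zero) , row→ i j i' j' e
gridAdj⇒nbr (i , j , p₄) (i' , j' , p₁) ()
gridAdj⇒nbr (i , j , p₄) (i' , j' , p₂) ()
gridAdj⇒nbr (i , j , p₄) (i' , j' , p₃) e = zero , inner← i j i' j' e
gridAdj⇒nbr (i , j , p₄) (i' , j' , p₄) ()
gridAdj⇒nbr (i , j , p₄) (i' , j' , p₅) e = suc zero , inner→ i j i' j' e
gridAdj⇒nbr (i , j , p₅) (i' , j' , p₀) ()
gridAdj⇒nbr (i , j , p₅) (i' , j' , p₁) e = suc (suc zero) , col→ i j i' j' e
gridAdj⇒nbr (i , j , p₅) (i' , j' , p₂) ()
gridAdj⇒nbr (i , j , p₅) (i' , j' , p₃) e = zero , inner← i j i' j' e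
gridAdj⇒nbr (i , j , p₅) (i' , j' , p₄) e = suc zero , inner← i j i' j' e
gridAdj⇒nbr (i , j , p₅) (i' , j' , p₅) ()

module Grid (M' : ℕ) where

  M : ℕ
  M = suc M'

  V : Set
  V = Fin (M * (M * 6))

  encode : Fin M → Fin M → Fin 6 → V
  encode r c p = combine r (combine c p)

  decode : V → Fin M × Fin M × Fin 6
  decode x = proj₁ rq , remQuot {M} 6 (proj₂ rq)
    where rq = remQuot {M} (M * 6) x

  rowOf colOf : V → Fin M
  rowOf = proj₁ ∘ decode
  colOf = proj₁ ∘ proj₂ ∘ decode

  cornerOf : V → Fin 6
  cornerOf = proj₂ ∘ proj₂ ∘ decode

  encode-decode : ∀ x → encode (rowOf x) (colOf x) (cornerOf x) ≡ x
  encode-decode x =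
    trans (cong (combine (proj₁ rq)) (combine-remQuot {M} 6 (proj₂ rq))) (combine-remQuot {M} (M * 6) x)
    where rq = remQuot {M} (M * 6) x

  decode-encode : ∀ r c p → decode (encode r c p) ≡ (r , c , p)
  decode-encode r c p =
    trans (cong (λ rq → proj₁ rq , remQuot {M} 6 (proj₂ rq)) (remQuot-combine {M} {M * 6} r (combine c p)))
          (cong (r ,_) (remQuot-combine {M} {6} c p))

  rowOf-encode : ∀ r c p → rowOf (encode r c p) ≡ r
  rowOf-encode r c p = cong proj₁ (decode-encode r c p)

  colOf-encode : ∀ r c p → colOf (encode r c p) ≡ c
  colOf-encode r c p = cong (proj₁ ∘ proj₂) (decode-encode r c p)

  coords : V → Coord
  coords x = toℕ (rowOf x) , toℕ (colOf x) , cornerOf x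

  vertexAt : Coord → V
  vertexAt (i , j , p) = encode (clamp M' i) (clamp M' j) p

  vertexAt-coords : ∀ x → vertexAt (coords x) ≡ x
  vertexAt-coords x rewrite clamp-toℕ (rowOf x) | clamp-toℕ (colOf x) = encode-decode x

  coords-injective : Injective _≡_ _≡_ coords
  coords-injective {x} {y} eq = trans (sym (vertexAt-coords x)) (trans (cong vertexAt eq) (vertexAt-coords y))

  InGrid : Coord → Set
  InGrid (i , j , _) = i ≤ M' × j ≤ M'

  coords-vertexAt : ∀ {c} → InGrid c → coords (vertexAt c) ≡ c
  coords-vertexAt {i , j , p} (i≤ , j≤) =
    trans (cong (λ (r , c , q) → toℕ r , toℕ c , q) (decode-encode (clamp M' i) (clamp M' j) p))
          (cong₂ (λ a b → a , b , p) (toℕ-clamp i≤) (toℕ-clamp j≤))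

  H : Adjacency (M * (M * 6))
  H x y = gridAdj (coords x) (coords y)

  H-sym : ∀ x y → H x y ≡ H y x
  H-sym x y = gridAdj-sym (coords x) (coords y)

  coGrid : Graph
  coGrid = mkGraph (M * (M * 6)) λ x y → not (x == y) ∧ not (H x y)

  coGrid-simple : IsSimple coGrid
  coGrid-simple = (λ x y → cong₂ (λ e h → not e ∧ not h) (==-sym x y) (H-sym x y))
                , (λ x → cong (λ e → not e ∧ not (H x x)) (==-refl x))

  coGrid-adj : ∀ {x y} → x ≢ y → adj coGrid x y ≡ not (H x y)
  coGrid-adj x≢y rewrite ==-false x≢y = refl

  nonNeighbour⇒slot : ∀ {d x} → NonNeighbour (adj coGrid) d x →
                      ∃ λ s → gridNbr (coords d) s ≡ coords x
  nonNeighbour⇒slot {d} {x} (x≢d , nonadj) =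
    gridAdj⇒nbr (coords d) (coords x) (not-injective (trans (sym (coGrid-adj (x≢d ∘ sym))) nonadj))

  module _ {n d} (f : Fin n → V) (f-inj : Injective _≡_ _≡_ f)
           (nonNbr : ∀ t → NonNeighbour (adj coGrid) d (f t)) where

    slot : Fin n → Fin 3
    slot t = proj₁ (nonNeighbour⇒slot (nonNbr t))

    slot-coords : ∀ t → gridNbr (coords d) (slot t) ≡ coords (f t)
    slot-coords t = proj₂ (nonNeighbour⇒slot (nonNbr t))

    slot-injective : Injective _≡_ _≡_ slot
    slot-injective {s} {t} eq = f-inj (coords-injective
      (trans (sym (slot-coords s)) (trans (cong (gridNbr (coords d)) eq) (slot-coords t))))

  coGrid-coDegree≤3 : CoDegree≤3 (adj coGrid)
  coGrid-coDegree≤3 d f f-inj nonNbr = <⇒notInjective ≤-refl (slot-injective f f-inj nonNbr)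

  -- Among three distinct H-neighbours of d two are the triangle mates of d, which are H-adjacent.
  coGrid-coClawFree : CoClawFree (adj coGrid)
  coGrid-coClawFree d f f-inj nonNbr leaves
    with endo-injective⇒surjective (slot-injective f f-inj nonNbr) zero
       | endo-injective⇒surjective (slot-injective f f-inj nonNbr) (suc zero)
  ... | s , slot-s | t , slot-t = true≢false (begin
    true                                                  ≡⟨ leaves s t s≢t ⟨
    adj coGrid (f s) (f t)                                ≡⟨ coGrid-adj (s≢t ∘ f-inj) ⟩
    not (gridAdj (coords (f s)) (coords (f t)))           ≡⟨ cong not (cong₂ gridAdj (at s slot-s) (at t slot-t)) ⟨
    not (gridAdj (gridNbr c zero) (gridNbr c (suc zero))) ≡⟨ cong not (mates-adj c) ⟩
    false                                                 ∎)
    where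
      open ≡-Reasoning
      c = coords d
      at : ∀ t {e} → slot f f-inj nonNbr t ≡ e → gridNbr c e ≡ coords (f t)
      at t refl = slot-coords f f-inj nonNbr t
      s≢t : s ≢ t
      s≢t refl = 0≢1+n (trans (sym slot-s) slot-t)
      true≢false : true ≢ false
      true≢false ()

  coGrid-coSubcubicClawFree : CoSubcubicClawFree coGrid
  coGrid-coSubcubicClawFree = record
    { adj-sym    = proj₁ coGrid-simple
    ; coDegree≤3 = coGrid-coDegree≤3
    ; coClawFree = coGrid-coClawFree
    }

  record Link (Q : Coord → Set) (x y : V) : Set where
    constructor link
    field
      source-in : Q (coords x)
      target-in : Q (coords y)
      adjacent  : H x y ≡ true

  link-sym : ∀ {Q x y} → Link Q x y → Link Q y x
  link-sym {x = x} {y} (link qx qy xy) = link qy qx (trans (H-sym y x) xy)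

  edge : ∀ {Q c c'} → InGrid c → InGrid c' → Q c → Q c' → gridAdj c c' ≡ true →
         Link Q (vertexAt c) (vertexAt c')
  edge {Q} g g' q q' cc' =
    link (subst Q (sym (coords-vertexAt g)) q) (subst Q (sym (coords-vertexAt g')) q')
         (trans (cong₂ gridAdj (coords-vertexAt g) (coords-vertexAt g')) cc')

  InCell : ℕ → ℕ → Coord → Set
  InCell i j (i' , j' , _) = i' ≡ i × j' ≡ j

  InRow : ℕ → Coord → Set
  InRow i (i' , _ , _) = i' ≡ i

  InCol : ℕ → Coord → Set
  InCol j (_ , j' , _) = j' ≡ j

  cell⇒row : ∀ {i j x y} → Link (InCell i j) x y → Link (InRow i) x y
  cell⇒row (link (x-row , _) (y-row , _) xy) = link x-row y-row xy

  cell⇒col : ∀ {i j x y} → Link (InCell i j) x y → Link (InCol j) x y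
  cell⇒col (link (_ , x-col) (_ , y-col) xy) = link x-col y-col xy

  withinCell : ∀ {i j} → i ≤ M' → j ≤ M' → ∀ p →
               Star (Link (InCell i j)) (vertexAt (i , j , p₀)) (vertexAt (i , j , p))
  withinCell {i} {j} i≤ j≤ = path
    where
      e : ∀ p q → edgeKind p q ≡ inner → Link (InCell i j) (vertexAt (i , j , p)) (vertexAt (i , j , q))
      e p q k = edge (i≤ , j≤) (i≤ , j≤) (refl , refl) (refl , refl) (cellAdj i j p q k)
      path : ∀ p → Star (Link (InCell i j)) (vertexAt (i , j , p₀)) (vertexAt (i , j , p))
      path p₀ = ε
      path p₁ = e p₀ p₁ refl ◅ ε
      path p₂ = e p₀ p₂ refl ◅ ε
      path p₃ = e p₀ p₂ refl ◅ e p₂ p₃ refl ◅ ε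
      path p₄ = e p₀ p₂ refl ◅ e p₂ p₃ refl ◅ e p₃ p₄ refl ◅ ε
      path p₅ = e p₀ p₂ refl ◅ e p₂ p₃ refl ◅ e p₃ p₅ refl ◅ ε

  alongRow : ∀ {i} → i ≤ M' → ∀ {j} → j ≤ M' →
             Star (Link (InRow i)) (vertexAt (i , 0 , p₀)) (vertexAt (i , j , p₀))
  alongRow i≤ {zero} _ = ε
  alongRow {i} i≤ {suc j} 1+j≤ =
    alongRow i≤ j≤ ◅◅ Star.map cell⇒row (withinCell i≤ j≤ p₄) ◅◅
    edge (i≤ , j≤) (i≤ , 1+j≤) refl refl (rowAdj i j) ◅ ε
    where j≤ = ≤-trans (n≤1+n j) 1+j≤

  alongCol : ∀ {j} → j ≤ M' → ∀ {i} → i ≤ M' →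
             Star (Link (InCol j)) (vertexAt (0 , j , p₀)) (vertexAt (i , j , p₀))
  alongCol j≤ {zero} _ = ε
  alongCol {j} j≤ {suc i} 1+i≤ =
    alongCol j≤ i≤ ◅◅ Star.map cell⇒col (withinCell i≤ j≤ p₅) ◅◅
    edge {c' = suc i , j , p₁} (i≤ , j≤) (1+i≤ , j≤) refl refl (colAdj i j) ◅
    link-sym (edge {c' = suc i , j , p₁} (1+i≤ , j≤) (1+i≤ , j≤) refl refl
                   (cellAdj (suc i) j p₀ p₁ refl)) ◅ ε
    where i≤ = ≤-trans (n≤1+n i) 1+i≤

  rowReach : ∀ x → Star (Link (InRow (toℕ (rowOf x)))) (vertexAt (toℕ (rowOf x) , 0 , p₀)) x
  rowReach x = subst (Star _ _) (vertexAt-coords x)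
    (alongRow i≤ j≤ ◅◅ Star.map cell⇒row (withinCell i≤ j≤ (cornerOf x)))
    where
      i≤ = toℕ≤pred[n] (rowOf x)
      j≤ = toℕ≤pred[n] (colOf x)

  colReach : ∀ x → Star (Link (InCol (toℕ (colOf x)))) (vertexAt (0 , toℕ (colOf x) , p₀)) x
  colReach x = subst (Star _ _) (vertexAt-coords x)
    (alongCol j≤ i≤ ◅◅ Star.map cell⇒col (withinCell i≤ j≤ (cornerOf x)))
    where
      i≤ = toℕ≤pred[n] (rowOf x)
      j≤ = toℕ≤pred[n] (colOf x)

  rowPath : ∀ {x y} → rowOf x ≡ rowOf y → Star (Link (InRow (toℕ (rowOf x)))) x y
  rowPath {x} {y} same = reverse link-sym (rowReach x) ◅◅
    subst (λ r → Star (Link (InRow (toℕ r))) (vertexAt (toℕ r , 0 , p₀)) y) (sym same) (rowReach y)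

  colPath : ∀ {x y} → colOf x ≡ colOf y → Star (Link (InCol (toℕ (colOf x)))) x y
  colPath {x} {y} same = reverse link-sym (colReach x) ◅◅
    subst (λ c → Star (Link (InCol (toℕ c))) (vertexAt (0 , toℕ c , p₀)) y) (sym same) (colReach y)

  Crossing : (V → Set) → (V → Fin M) → V → Set
  Crossing P line x = ∃₂ λ b z → line b ≡ line x × H b z ≡ true × P b × ¬ P z

  module _ {P : V → Set} (P? : Decidable P) where

    rowCrossing : ∀ {x y} → rowOf x ≡ rowOf y → P x → ¬ P y → Crossing P rowOf x
    rowCrossing same px ¬py with crossing P? (rowPath same) px ¬py
    ... | b , z , link b-row _ bz , pb , ¬pz = b , z , toℕ-injective b-row , bz , pb , ¬pz

    colCrossing : ∀ {x y} → colOf x ≡ colOf y → P x → ¬ P y → Crossing P colOf x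
    colCrossing same px ¬py with crossing P? (colPath same) px ¬py
    ... | b , z , link b-col _ bz , pb , ¬pz = b , z , toℕ-injective b-col , bz , pb , ¬pz

-- Counting the vertices of a piece of the grid

module Counting (k M' : ℕ) where
  open Grid M'

  module _ {m'} (σ : Fin m' → V) (σ-inj : Injective _≡_ _≡_ σ) (m'<M : m' < M) (L : Fin m' → Fin k)
           (twins : ∀ a a' → L a ≡ L a' → ∀ z → (∀ w → σ w ≢ z) → H (σ a) z ≡ H (σ a') z)
           where

    _∈S : V → Set
    x ∈S = ∃ λ a → σ a ≡ x

    _∈S? : Decidable _∈S
    x ∈S? = any? (λ a → σ a ≟ x)

    OutsideNbr : Fin m' → V → Set
    OutsideNbr a z = ¬ z ∈S × H (σ a) z ≡ true

    outsideNbr? : ∀ a → Decidable (OutsideNbr a)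
    outsideNbr? a z = ¬? (z ∈S?) ×-dec (H (σ a) z ≟ᵇ true)

    outsideNbr-twins : ∀ {a a'} → L a ≡ L a' → ∀ z → OutsideNbr a z → OutsideNbr a' z
    outsideNbr-twins {a} {a'} same z (z∉S , az) =
      z∉S , trans (sym (twins a a' same z (λ w σw≡z → z∉S (w , σw≡z)))) az

    -- A boundary vertex is an H-neighbour of its first outside neighbour, which depends only on
    -- its label; so the label and the slot in that neighbour's neighbourhood determine it.
    boundary≤3k : (g : Fin (suc (k * 3)) → Fin m') → Injective _≡_ _≡_ g →
                  (∀ t → ∃ (OutsideNbr (g t))) → ⊥
    boundary≤3k g g-inj boundary = <⇒notInjective ≤-refl code-injective
      where
        chosen : ∀ t → ∃ λ z → first (outsideNbr? (g t)) ≡ just z × OutsideNbr (g t) z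
        chosen t = first-complete (outsideNbr? (g t)) (proj₂ (boundary t))
        nbr : ∀ t → V
        nbr t = proj₁ (chosen t)
        dir : ∀ t → ∃ λ d → gridNbr (coords (nbr t)) d ≡ coords (σ (g t))
        dir t = gridAdj⇒nbr (coords (nbr t)) (coords (σ (g t)))
                  (trans (H-sym (nbr t) (σ (g t))) (proj₂ (proj₂ (proj₂ (chosen t)))))
        code : Fin (suc (k * 3)) → Fin (k * 3)
        code t = combine (L (g t)) (proj₁ (dir t))
        code-injective : Injective _≡_ _≡_ code
        code-injective {t} {t'} eq = g-inj (σ-inj (coords-injective (begin
          coords (σ (g t))                           ≡⟨ proj₂ (dir t) ⟨
          gridNbr (coords (nbr t)) (proj₁ (dir t))   ≡⟨ cong₂ (gridNbr ∘ coords) same-nbr same-dir ⟩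
          gridNbr (coords (nbr t')) (proj₁ (dir t')) ≡⟨ proj₂ (dir t') ⟩
          coords (σ (g t'))                          ∎)))
          where
            open ≡-Reasoning
            same-L   = proj₁ (combine-injective (L (g t)) _ (L (g t')) _ eq)
            same-dir = proj₂ (combine-injective (L (g t)) _ (L (g t')) _ eq)
            same-nbr : nbr t ≡ nbr t'
            same-nbr = just-injective (begin
              just (nbr t)               ≡⟨ proj₁ (proj₂ (chosen t)) ⟨
              first (outsideNbr? (g t))  ≡⟨ first-cong (outsideNbr? (g t)) (outsideNbr? (g t'))
                                              (outsideNbr-twins same-L) (outsideNbr-twins (sym same-L)) ⟩
              first (outsideNbr? (g t')) ≡⟨ proj₁ (proj₂ (chosen t')) ⟩
              just (nbr t')              ∎)

    missed : (line : Fin M → V) → Injective _≡_ _≡_ line → ∃ λ c → ¬ line c ∈S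
    missed line line-inj = ¬∀⟶∃¬ M _ (λ c → line c ∈S?) λ all →
      <⇒notInjective m'<M (λ {c} {c'} eq →
        line-inj (trans (sym (proj₂ (all c))) (trans (cong σ eq) (proj₂ (all c')))))

    module Lines (lineOf : V → Fin M) (line : Fin M → Fin M → V)
                 (line-injective : ∀ r → Injective _≡_ _≡_ (line r))
                 (lineOf-line : ∀ r c → lineOf (line r c) ≡ r)
                 (lineCrossing : ∀ {x y} → lineOf x ≡ lineOf y → x ∈S → ¬ y ∈S →
                                 Crossing _∈S lineOf x)
                 where

      -- Every line met by S also contains a vertex outside S, hence a boundary vertex.
      fewLines : (E : ImageEnumeration (lineOf ∘ σ)) → ImageEnumeration.count E ≤ k * 3
      fewLines E with suc (k * 3) ≤? ImageEnumeration.count E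
      ... | no  few    = s≤s⁻¹ (≰⇒> few)
      ... | yes enough = ⊥-elim (boundary≤3k g g-inj outside)
        where
          open ImageEnumeration E
          a : Fin (suc (k * 3)) → Fin m'
          a t = rep (inject≤ t enough)
          crossingAt : ∀ t → Crossing _∈S lineOf (σ (a t))
          crossingAt t = lineCrossing (sym (lineOf-line r (proj₁ miss))) (a t , refl) (proj₂ miss)
            where
              r = lineOf (σ (a t))
              miss = missed (line r) (line-injective r)
          b : Fin (suc (k * 3)) → V
          b t = proj₁ (crossingAt t)
          b∈S : ∀ t → b t ∈S
          b∈S t = proj₁ (proj₂ (proj₂ (proj₂ (proj₂ (crossingAt t)))))
          g : Fin (suc (k * 3)) → Fin m'
          g t = proj₁ (b∈S t)
          g-inj : Injective _≡_ _≡_ g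
          g-inj {t} {t'} eq = inject≤-injective _ _ t t' (rep-distinct (begin
            lineOf (σ (a t))   ≡⟨ proj₁ (proj₂ (proj₂ (crossingAt t))) ⟨
            lineOf (b t)       ≡⟨ cong lineOf same-b ⟩
            lineOf (b t')      ≡⟨ proj₁ (proj₂ (proj₂ (crossingAt t'))) ⟩
            lineOf (σ (a t'))  ∎))
            where
              open ≡-Reasoning
              same-b = trans (sym (proj₂ (b∈S t))) (trans (cong σ eq) (proj₂ (b∈S t')))
          outside : ∀ t → ∃ (OutsideNbr (g t))
          outside t with crossingAt t | b∈S t
          ... | _ , z , _ , bz , _ , z∉S | _ , σg≡b = z , z∉S , trans (cong (λ v → H v z) σg≡b) bz

    module Rows = Lines rowOf (λ r c → encode r c p₀)
      (λ r {c} {c'} eq → trans (sym (colOf-encode r c p₀)) (trans (cong colOf eq) (colOf-encode r c' p₀)))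
      (λ r c → rowOf-encode r c p₀) (rowCrossing _∈S?)

    module Cols = Lines colOf (λ c r → encode r c p₀)
      (λ c {r} {r'} eq → trans (sym (rowOf-encode r c p₀)) (trans (cong rowOf eq) (rowOf-encode r' c p₀)))
      (λ c r → colOf-encode r c p₀) (colCrossing _∈S?)

    -- A vertex of S is fixed by its row and column, each among at most 3k, and its corner.
    size-bound : m' ≤ k * 3 * (k * 3 * 6)
    size-bound = ≤-trans (injective⇒≤ code-injective)
                         (*-mono-≤ (Rows.fewLines R) (*-mono-≤ (Cols.fewLines C) ≤-refl))
      where
        R = enumerateImage (rowOf ∘ σ)
        C = enumerateImage (colOf ∘ σ)
        open ImageEnumeration
        code : Fin m' → Fin (count R * (count C * 6))
        code a = combine (index R a) (combine (index C a) (cornerOf (σ a)))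
        code-injective : Injective _≡_ _≡_ code
        code-injective {a} {a'} eq = σ-inj (coords-injective
          (cong₂ _,_ (cong toℕ same-row) (cong₂ _,_ (cong toℕ same-col) same-corner)))
          where
            rest = proj₂ (combine-injective (index R a) _ (index R a') _ eq)
            same-corner = proj₂ (combine-injective (index C a) _ (index C a') _ rest)
            same-row : rowOf (σ a) ≡ rowOf (σ a')
            same-row = trans (sym (index-sound R a))
              (trans (cong (rowOf ∘ σ ∘ rep R) (proj₁ (combine-injective (index R a) _ (index R a') _ eq)))
                     (index-sound R a'))
            same-col : colOf (σ a) ≡ colOf (σ a')
            same-col = trans (sym (index-sound C a))
              (trans (cong (colOf ∘ σ ∘ rep C) (proj₁ (combine-injective (index C a) _ (index C a') _ rest)))
                     (index-sound C a'))

-- The complemented grid has clique-width greater than k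

pieceSize gridSize : ℕ → ℕ
pieceSize k = suc (k * 3 * (k * 3 * 6))
gridSize k = pieceSize k + pieceSize k

module _ {M' k n} {e : CWExpr k n} (coGrid≅e : Grid.coGrid M' ≅ graphOf e) {m} (P : Piece e m) where
  open Grid M'
  open _≅_ coGrid≅e
  open Piece P

  pieceVertex : Fin card → V
  pieceVertex = from ∘ embed

  pieceVertex-injective : Injective _≡_ _≡_ pieceVertex
  pieceVertex-injective {a} {a'} eq =
    embed-injective (trans (sym (to-from (embed a))) (trans (cong to eq) (to-from (embed a'))))

  pieceVertex-twins : ∀ a a' → label a ≡ label a' → ∀ z → (∀ w → pieceVertex w ≢ z) →
                      H (pieceVertex a) z ≡ H (pieceVertex a') z
  pieceVertex-twins a a' same z outside = not-injective (begin
    not (H (pieceVertex a) z)     ≡⟨ coGrid-adj (outside a) ⟨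
    adj coGrid (pieceVertex a) z  ≡⟨ adj-piece a ⟩
    adj⟦ e ⟧ (embed a) (to z)     ≡⟨ proj₂ (twins a a' same) (to z) to-outside ⟩
    adj⟦ e ⟧ (embed a') (to z)    ≡⟨ adj-piece a' ⟨
    adj coGrid (pieceVertex a') z ≡⟨ coGrid-adj (outside a') ⟩
    not (H (pieceVertex a') z)    ∎)
    where
      open ≡-Reasoning
      adj-piece : ∀ a → adj coGrid (pieceVertex a) z ≡ adj⟦ e ⟧ (embed a) (to z)
      adj-piece a = trans (pres (pieceVertex a) z) (cong (λ x → adj⟦ e ⟧ x (to z)) (to-from (embed a)))
      to-outside : ∀ w → embed w ≢ to z
      to-outside w eq = outside w (trans (cong from eq) (from-to z))

coGrid-cw>k : ∀ k → ¬ cw≤ k (Grid.coGrid (gridSize k))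
coGrid-cw>k k (n , e , coGrid≅e) =
  <⇒≱ ≤-refl (≤-trans m≤card (Counting.size-bound k (gridSize k)
    (pieceVertex coGrid≅e P) (pieceVertex-injective coGrid≅e P) (≤-trans card<2m (n≤1+n _))
    label (pieceVertex-twins coGrid≅e P)))
  where
    open Grid (gridSize k)
    pieceSize≤n : pieceSize k ≤ n
    pieceSize≤n = ≤-trans (≤-trans (m≤m+n (pieceSize k) _) (≤-trans (n≤1+n _) (m≤m*n M (M * 6))))
                          (injective⇒≤ (_↪_.embed-injective (≅⇒↪ coGrid≅e)))
    P = piece e (s≤s z≤n) pieceSize≤n
    open Piece P

mainTheorem4 : ¬ BoundedCW K3∪K1-IMfree
mainTheorem4 (k , bounded) =
  coGrid-cw>k k (bounded coGrid (coGrid-simple , coSubcubicClawFree⇒K3∪K1-free coGrid-coSubcubicClawFree))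
  where open Grid (gridSize k)
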